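{- Let $q=p^r$ with $p$ prime, let $k\geqslant 2$, and let $0\leqslant j\leqslant q-2$ be such that the class $C_j$ has exactly two elements. Let $M_j$ be the $2\times 2$ matrix of the Atkin operator $U_t$ restricted to the span of $C_j$. If it is not the case that [$q$ is even, $k$ is odd and $M_j$ is antidiagonal (i.e. both diagonal entries of $M_j$ are zero)], then $M_j$ is diagonalizable over $\mathbb{C}_\infty$.
   Context: Let $A=\mathbb{F}_q[t]$, $F_\infty=\mathbb{F}_q((1/t))$, $\mathbb{C}_\infty$ the completion of an algebraic closure of $F_\infty$, and $\Omega=\mathbb{P}^1(\mathbb{C}_\infty)-\mathbb{P}^1(F_\infty)$ the Drinfeld upper half plane (a rigid analytic space). Let $\Gamma_1(t)=\{\gamma\in GL_2(A):\gamma\equiv\left(\begin{smallmatrix}1&*\\0&1\end{smallmatrix}\right)\pmod t\}$ (all its elements have determinant $1$). $S^1_k(\Gamma_1(t))$ denotes the $\mathbb{C}_\infty$-space of Drinfeld cusp forms of weight $k$ for $\Gamma_1(t)$: rigid analytic $f:\Omega\to\mathbb{C}_\infty$ with $f(\gamma z)(cz+d)^{ -k}=f(z)$ for all $\gamma=\left(\begin{smallmatrix}a&b\\c&d\end{smallmatrix}\right)\in\Gamma_1(t)$, holomorphic and vanishing at all cusps. The Atkin operator is $U_t(f)(z)=\sum_{\beta\in\mathbb{F}_q}f\big(\frac{z+\beta}{t}\big)$ (up to a nonzero normalizing scalar). Via Teitelbaum's isomorphism with $\Gamma_1(t)$-equivariant harmonic cocycles on the Bruhat–Tits tree, $S^1_k(\Gamma_1(t))$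 has dimension $k-1$ and a basis $c_0,\dots,c_{k-2}$ (where $c_j$ is the cocycle whose value on the unique stable edge $\overline{e}$ of the fundamental domain satisfies $c_j(\overline{e})(X^iY^{k-2-i})=\delta_{ij}$), on which $$U_t(c_j)=-(-t)^{j+1}\binom{k-2-j}{j}c_j-t^{j+1}\sum_{h\neq 0}\left[\binom{k-2-j-h(q-1)}{ -h(q-1)}+(-1)^{j+1}\binom{k-2-j-h(q-1)}{j}\right]c_{j+h(q-1)},$$ with the convention $c_i=0$ if $i<0$ or $i>k-2$, binomial coefficients $\binom{n}{m}$ taken as integers reduced into $\mathbb{F}_p\subset\mathbb{C}_\infty$ and equal to $0$ if $m<0$ or $m>n$. For $0\leqslant j\leqslant q-2$, $C_j=\{c_\ell:0\leqslant \ell\leqslant k-2,\ \ell\equiv j\pmod{q-1}\}$; the span of $C_j$ is $U_t$-stable and $M_j$ is the matrix of $U_t$ on it in the basis $C_j$ ordered by increasing $\ell$. -}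

module Defs where

open import Level using (Level; _⊔_)
open import Data.Nat as ℕ using (ℕ; zero; suc; _∸_; _≤_; _%_; _/_; _≡ᵇ_; _<ᵇ_)
open import Data.Nat.Combinatorics using (_C_)
open import Data.Nat.Divisibility using (_∣_)
open import Data.Integer as ℤ using (ℤ; +_; -[1+_])
open import Data.Bool using (if_then_else_)
open import Data.Fin using (Fin; zero; suc)
open import Data.List using (List; []; _∷_; _++_; [_]; length; filter; upTo; lookup; map)
open import Data.List.Relation.Unary.Any using (Any)
open import Data.Product using (Σ; ∃; _×_; _,_)
open import Relation.Nullary using (¬_)
open import Relation.Binary.PropositionalEquality using (_≡_)
open import Algebra.Bundles using (CommutativeRing)

-- Binomial coefficient with integer arguments, as an integer (natural number):
-- binom(n,m) = 0 if m < 0 or m > n  (for m ≥ 0 > n this is the case m > n);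
-- otherwise the usual binomial coefficient.  (_C_ is 0 when m > n.)
binZ : ℤ → ℤ → ℕ
binZ n -[1+ _ ] = 0
binZ -[1+ _ ] (+ m) = 0
binZ (+ n) (+ m) = n C m

-- The class C_j: the indices ℓ with 0 ≤ ℓ ≤ k-2 and ℓ ≡ j (mod q-1),
-- in increasing order.  (q-1 is written suc (q ∸ 2); we always assume q ≥ 2.)
Cls : (q k j : ℕ) → List ℕ
Cls q k j = filter (λ ℓ → ℓ % suc (q ∸ 2) ℕ.≟ j % suc (q ∸ 2)) (upTo (k ∸ 1))

module Over {c ℓ : Level} (K : CommutativeRing c ℓ) where
  open CommutativeRing K hiding (zero)

  castℕ : ℕ → Carrier
  castℕ zero = 0#
  castℕ (suc n) = 1# + castℕ n

  pow : Carrier → ℕ → Carrier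
  pow x zero = 1#
  pow x (suc n) = x * pow x n

  -- evaluation of a polynomial given by its coefficient list (constant term first)
  evalP : List Carrier → Carrier → Carrier
  evalP [] x = 0#
  evalP (a ∷ as) x = a + x * evalP as x

  IsField : Set (c ⊔ ℓ)
  IsField = (¬ (1# ≈ 0#)) × (∀ x → ¬ (x ≈ 0#) → Σ Carrier λ y → x * y ≈ 1#)

  -- K is algebraically closed: every monic polynomial of degree ≥ 1 has a root
  IsAlgClosed : Set (c ⊔ ℓ)
  IsAlgClosed = ∀ (as : List Carrier) → 1 ≤ length as →
                Σ Carrier λ x → evalP (as ++ [ 1# ]) x ≈ 0#

  HasChar : ℕ → Set ℓ
  HasChar p = castℕ p ≈ 0#

  -- t is transcendental over the prime field F_p ⊆ K: no nonzero polynomial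
  -- with coefficients in F_p (given as naturals, not all divisible by p) vanishes at t
  Transcendental : ℕ → Carrier → Set ℓ
  Transcendental p t = ∀ (as : List ℕ) → Any (λ a → ¬ (p ∣ a)) as →
                       ¬ (evalP (map castℕ as) t ≈ 0#)

  Mat : ℕ → Set c
  Mat n = Fin n → Fin n → Carrier

  sumF : ∀ n → (Fin n → Carrier) → Carrier
  sumF zero f = 0#
  sumF (suc n) f = f zero + sumF n (λ i → f (suc i))

  _⊗_ : ∀ {n} → Mat n → Mat n → Mat n
  _⊗_ {n} A B i j = sumF n (λ l → A i l * B l j)

  idM : ∀ {n} → Mat n
  idM zero zero = 1#
  idM zero (suc j) = 0#
  idM (suc i) zero = 0#
  idM (suc i) (suc j) = idM i j

  diagM : ∀ {n} → (Fin n → Carrier) → Mat n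
  diagM d i j = idM i j * d j

  _≈M_ : ∀ {n} → Mat n → Mat n → Set ℓ
  A ≈M B = ∀ i j → A i j ≈ B i j

  Diagonalizable : ∀ {n} → Mat n → Set (c ⊔ ℓ)
  Diagonalizable {n} M =
    Σ (Mat n) λ P → Σ (Mat n) λ Q → Σ (Fin n → Carrier) λ d →
      ((P ⊗ Q) ≈M idM) × ((Q ⊗ P) ≈M idM) × ((M ⊗ P) ≈M (P ⊗ diagM d))

  binK : ℤ → ℤ → Carrier
  binK n m = castℕ (binZ n m)

  sgn : ℕ → Carrier
  sgn n = pow (- 1#) n

  -- Coefficient of c_{j + h(q-1)} (h ≠ 0) in U_t(c_j), from the formula:
  --   - t^{j+1} [ binom(k-2-j-h(q-1), -h(q-1)) + (-1)^{j+1} binom(k-2-j-h(q-1), j) ]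
  offCoef : Carrier → (q k j : ℕ) → ℤ → Carrier
  offCoef t q k j h =
    let n = (+ k ℤ.- + 2) ℤ.- + j ℤ.- h ℤ.* + (q ∸ 1) in
    - (pow t (suc j) * (binK n (ℤ.- (h ℤ.* + (q ∸ 1))) + sgn (suc j) * binK n (+ j)))

  -- Coefficient of c_j in U_t(c_j):  - (-t)^{j+1} binom(k-2-j, j)
  diagCoef : Carrier → (q k j : ℕ) → Carrier
  diagCoef t q k j = - (pow (- t) (suc j) * binK ((+ k ℤ.- + 2) ℤ.- + j) (+ j))

  -- Coefficient of c_i in U_t(c_j), for i ≡ j (mod q-1), i.e. i = j + h(q-1)
  -- with h = (i - j)/(q-1).
  Ucoef : Carrier → (q k j i : ℕ) → Carrier
  Ucoef t q k j i =
    if i ≡ᵇ j then diagCoef t q k j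
    else if j <ᵇ i then offCoef t q k j (+ ((i ∸ j) / suc (q ∸ 2)))
    else offCoef t q k j (ℤ.- (+ ((j ∸ i) / suc (q ∸ 2))))

  -- M_j: matrix of U_t on span(C_j) in the basis C_j (increasing order);
  -- column b holds the coordinates of U_t(c_{ℓ_b}), i.e. entry (a,b) is the
  -- coefficient of c_{ℓ_a} in U_t(c_{ℓ_b}).
  Mj : Carrier → (q k j : ℕ) → Mat (length (Cls q k j))
  Mj t q k j a b = Ucoef t q k (lookup (Cls q k j) b) (lookup (Cls q k j) a)

  DiagZero : ∀ {n} → Mat n → Set ℓ
  DiagZero M = ∀ i → M i i ≈ 0#

module Submission where

-- Write D = q - 1.  A two-element class is {c_j, c_(j+D)} with k - 2 = j + D + n
-- and j, n < D (ResidueClass), and M_j = [[a, b], [c, 0]] with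
-- a = -(-t)^(j+1) C(D+n, j) and b, c explicit (AtkinMatrix).  Over an
-- algebraically closed field a 2×2 matrix is diagonalizable when it is diagonal
-- or has nonzero discriminant a² + 4bc (TwoByTwo).  If p ∤ C(D+n, j), the
-- discriminant is t^(2j+2) (A² + 4 t^D B C) with p ∤ A, a nonzero polynomial in
-- the transcendental t (TranscendentalElement).  If p ∣ C(D+n, j), Lucas-type
-- congruences modulo q = p^r (PrimeCharacteristic) give a = 0 and b, c = ± t^(…) h
-- with h = C(n-1, j-1): if p ∣ h the matrix vanishes, if p ≠ 2 then 4bc ≠ 0, and
-- if p = 2 either k is odd (the excluded case) or a parity argument gives 2 ∣ h
-- (Binomial.even-binomial).

open import Defs
open import Level using (Level)
open import Algebra.Bundles using (CommutativeRing)
open import Data.Nat as ℕ using (ℕ; zero; suc; _<_; _≤_; s≤s; _∸_; _^_; _≡ᵇ_; _<ᵇ_)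
import Data.Nat.Properties as ℕP
open import Data.Nat.Divisibility using (_∣_; _∣?_; divides; ∣m+n∣m⇒∣n; ∣m∣n⇒∣m+n; ∣-refl)
open import Data.Nat.DivMod using (_/_; n/n≡1)
open import Data.Nat.Primality using (Prime; euclidsLemma; prime⇒nonZero)
open import Data.Nat.Combinatorics using (_C_; nCn≡1; k>n⇒nCk≡0)
open import Data.Nat.Solver using (module +-*-Solver)
open import Data.Integer as ℤ using (ℤ; +_; -[1+_]; _⊖_)
import Data.Integer.Properties as ℤP
open import Data.Bool using (true; false)
open import Data.Fin using (Fin; zero; suc)
open import Data.List using (List; []; _∷_; _++_; [_]; length; lookup; map)
open import Data.List.Relation.Unary.Any using (here; there)
open import Data.Maybe using (Maybe; just; nothing)
open import Data.Product using (_×_; _,_; proj₁; proj₂)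
open import Data.Sum using (inj₁; inj₂)
open import Data.Empty using (⊥; ⊥-elim)
open import Relation.Nullary using (¬_; Dec; yes; no)
open import Relation.Binary.PropositionalEquality as P using (_≡_)
import Algebra.Solver.Ring as RingSolver
import Algebra.Solver.Ring.AlmostCommutativeRing as ACR

-- Arithmetic in an arbitrary commutative ring K: the canonical maps ℕ → K and
-- ℤ → K (the latter makes the ring solver available over K, with integer
-- coefficients) and powers.
module RingArithmetic {c ℓ : Level} (K : CommutativeRing c ℓ) where
  open CommutativeRing K hiding (zero)
  open Over K using (castℕ; pow)
  open import Algebra.Properties.Ring ring using (-0#≈0#; -‿involutive; -‿+-comm; -‿distribˡ-*; -‿distribʳ-*)
  open import Algebra.Properties.Semiring.Mult semiring using (×-homo-+; ×1-homo-*) renaming (_×_ to _×ᵤ_)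
  open import Algebra.Properties.Semiring.Mult.TCOptimised semiring
    using (×ᵤ≈×) renaming (_×_ to _×′_; ×-homo-+ to ×′-homo-+; ×1-homo-* to ×′1-homo-*)
  open import Relation.Binary.Reasoning.Setoid setoid

  castℕ≈×ᵤ : ∀ n → castℕ n ≈ n ×ᵤ 1#
  castℕ≈×ᵤ zero = refl
  castℕ≈×ᵤ (suc n) = +-congˡ (castℕ≈×ᵤ n)

  castℕ-+ : ∀ m n → castℕ (m ℕ.+ n) ≈ castℕ m + castℕ n
  castℕ-+ m n = begin
    castℕ (m ℕ.+ n)    ≈⟨ castℕ≈×ᵤ (m ℕ.+ n) ⟩
    (m ℕ.+ n) ×ᵤ 1#    ≈⟨ ×-homo-+ 1# m n ⟩
    m ×ᵤ 1# + n ×ᵤ 1#  ≈⟨ +-cong (castℕ≈×ᵤ m) (castℕ≈×ᵤ n) ⟨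
    castℕ m + castℕ n  ∎

  castℕ-* : ∀ m n → castℕ (m ℕ.* n) ≈ castℕ m * castℕ n
  castℕ-* m n = begin
    castℕ (m ℕ.* n)        ≈⟨ castℕ≈×ᵤ (m ℕ.* n) ⟩
    (m ℕ.* n) ×ᵤ 1#        ≈⟨ ×1-homo-* m n ⟩
    (m ×ᵤ 1#) * (n ×ᵤ 1#)  ≈⟨ *-cong (castℕ≈×ᵤ m) (castℕ≈×ᵤ n) ⟨
    castℕ m * castℕ n      ∎

  -- It is built on the optimised
  -- multiple n ×′ 1# (for which 1 ×′ 1# is 1#), so that integer constants of
  -- the ring solver evaluate to the expected elements of K.
  ιℕ : ℕ → Carrier
  ιℕ n = n ×′ 1#

  castℕ≈ιℕ : ∀ n → castℕ n ≈ ιℕ n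
  castℕ≈ιℕ n = trans (castℕ≈×ᵤ n) (×ᵤ≈× n 1#)

  ιℕ-suc : ∀ n → ιℕ (suc n) ≈ 1# + ιℕ n
  ιℕ-suc n = ×′-homo-+ 1# 1 n

  castℤ : ℤ → Carrier
  castℤ (+ n) = ιℕ n
  castℤ -[1+ n ] = - ιℕ (suc n)

  castℤ-⊖ : ∀ m n → castℤ (m ⊖ n) ≈ ιℕ m - ιℕ n
  castℤ-⊖ zero zero = sym (trans (+-congˡ -0#≈0#) (+-identityʳ 0#))
  castℤ-⊖ (suc m) zero = sym (trans (+-congˡ -0#≈0#) (+-identityʳ _))
  castℤ-⊖ zero (suc n) = sym (+-identityˡ _)
  castℤ-⊖ (suc m) (suc n) = begin
    castℤ (suc m ⊖ suc n)            ≡⟨ P.cong castℤ (ℤP.[1+m]⊖[1+n]≡m⊖n m n) ⟩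
    castℤ (m ⊖ n)                    ≈⟨ castℤ-⊖ m n ⟩
    ιℕ m - ιℕ n                      ≈⟨ +-congʳ (+-identityˡ (ιℕ m)) ⟨
    (0# + ιℕ m) - ιℕ n               ≈⟨ +-congʳ (+-congʳ (-‿inverseʳ 1#)) ⟨
    ((1# - 1#) + ιℕ m) - ιℕ n        ≈⟨ shuffle ⟩
    (1# + ιℕ m) + (- 1# - ιℕ n)      ≈⟨ +-cong (ιℕ-suc m) (trans (-‿cong (ιℕ-suc n)) (sym (-‿+-comm 1# (ιℕ n)))) ⟨
    ιℕ (suc m) - ιℕ (suc n)          ∎
    where
    shuffle : ((1# - 1#) + ιℕ m) - ιℕ n ≈ (1# + ιℕ m) + (- 1# - ιℕ n)
    shuffle = begin
      ((1# - 1#) + ιℕ m) - ιℕ n      ≈⟨ +-congʳ (+-assoc 1# (- 1#) (ιℕ m)) ⟩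
      (1# + (- 1# + ιℕ m)) - ιℕ n    ≈⟨ +-congʳ (+-congˡ (+-comm (- 1#) (ιℕ m))) ⟩
      (1# + (ιℕ m - 1#)) - ιℕ n      ≈⟨ +-congʳ (+-assoc 1# (ιℕ m) (- 1#)) ⟨
      ((1# + ιℕ m) - 1#) - ιℕ n      ≈⟨ +-assoc (1# + ιℕ m) (- 1#) (- ιℕ n) ⟩
      (1# + ιℕ m) + (- 1# - ιℕ n)    ∎

  castℤ-neg : ∀ i → castℤ (ℤ.- i) ≈ - castℤ i
  castℤ-neg (+ zero) = sym -0#≈0#
  castℤ-neg (+ suc n) = refl
  castℤ-neg -[1+ n ] = sym (-‿involutive _)

  castℤ-+ : ∀ i j → castℤ (i ℤ.+ j) ≈ castℤ i + castℤ j
  castℤ-+ (+ m) (+ n) = ×′-homo-+ 1# m n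
  castℤ-+ (+ m) -[1+ n ] = castℤ-⊖ m (suc n)
  castℤ-+ -[1+ m ] (+ n) = trans (castℤ-⊖ n (suc m)) (+-comm _ _)
  castℤ-+ -[1+ m ] -[1+ n ] = begin
    - ιℕ (suc (suc (m ℕ.+ n)))   ≡⟨ P.cong (λ x → - ιℕ (suc x)) (P.sym (ℕP.+-suc m n)) ⟩
    - ιℕ (suc m ℕ.+ suc n)       ≈⟨ -‿cong (×′-homo-+ 1# (suc m) (suc n)) ⟩
    - (ιℕ (suc m) + ιℕ (suc n))  ≈⟨ -‿+-comm _ _ ⟨
    - ιℕ (suc m) - ιℕ (suc n)    ∎

  castℤ-*⁺ : ∀ m j → castℤ (+ m ℤ.* j) ≈ ιℕ m * castℤ j
  castℤ-*⁺ m (+ n) = P.subst (λ z → castℤ z ≈ ιℕ m * ιℕ n) (ℤP.pos-* m n) (×′1-homo-* m n)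
  castℤ-*⁺ m -[1+ n ] = begin
    castℤ (+ m ℤ.* -[1+ n ])          ≡⟨ P.cong castℤ (P.sym (ℤP.neg-distribʳ-* (+ m) (+ suc n))) ⟩
    castℤ (ℤ.- (+ m ℤ.* + suc n))     ≈⟨ castℤ-neg (+ m ℤ.* + suc n) ⟩
    - castℤ (+ m ℤ.* + suc n)         ≈⟨ -‿cong (castℤ-*⁺ m (+ suc n)) ⟩
    - (ιℕ m * ιℕ (suc n))             ≈⟨ -‿distribʳ-* _ _ ⟩
    ιℕ m * - ιℕ (suc n)               ∎

  castℤ-* : ∀ i j → castℤ (i ℤ.* j) ≈ castℤ i * castℤ j
  castℤ-* (+ m) j = castℤ-*⁺ m j
  castℤ-* -[1+ m ] j = begin
    castℤ (-[1+ m ] ℤ.* j)            ≡⟨ P.cong castℤ (P.sym (ℤP.neg-distribˡ-* (+ suc m) j)) ⟩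
    castℤ (ℤ.- (+ suc m ℤ.* j))       ≈⟨ castℤ-neg (+ suc m ℤ.* j) ⟩
    - castℤ (+ suc m ℤ.* j)           ≈⟨ -‿cong (castℤ-*⁺ (suc m) j) ⟩
    - (ιℕ (suc m) * castℤ j)          ≈⟨ -‿distribˡ-* _ _ ⟩
    - ιℕ (suc m) * castℤ j            ∎

  castℤ-homomorphism : ACR._-Raw-AlmostCommutative⟶_ (CommutativeRing.rawRing ℤP.+-*-commutativeRing) (ACR.fromCommutativeRing K)
  castℤ-homomorphism = record
    { ⟦_⟧ = castℤ ; +-homo = castℤ-+ ; *-homo = castℤ-* ; -‿homo = castℤ-neg
    ; 0-homo = refl ; 1-homo = refl }

  castℤ-equal? : ∀ i j → Maybe (castℤ i ≈ castℤ j)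
  castℤ-equal? i j with i ℤP.≟ j
  ... | yes P.refl = just refl
  ... | no _ = nothing

  open RingSolver (CommutativeRing.rawRing ℤP.+-*-commutativeRing) (ACR.fromCommutativeRing K)
    castℤ-homomorphism castℤ-equal? public

  pow-+ : ∀ x m n → pow x (m ℕ.+ n) ≈ pow x m * pow x n
  pow-+ x zero n = sym (*-identityˡ _)
  pow-+ x (suc m) n = trans (*-congˡ (pow-+ x m n)) (sym (*-assoc _ _ _))

  pow-neg-square : ∀ x n → pow (- x) n * pow (- x) n ≈ pow x n * pow x n
  pow-neg-square x zero = refl
  pow-neg-square x (suc n) = begin
    (- x * pow (- x) n) * (- x * pow (- x) n) ≈⟨ solve 2 (λ x y → (:- x :* y) :* (:- x :* y) := (x :* x) :* (y :* y)) refl x (pow (- x) n) ⟩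
    (x * x) * (pow (- x) n * pow (- x) n)     ≈⟨ *-congˡ (pow-neg-square x n) ⟩
    (x * x) * (pow x n * pow x n)             ≈⟨ solve 2 (λ x y → (x :* x) :* (y :* y) := (x :* y) :* (x :* y)) refl x (pow x n) ⟩
    (x * pow x n) * (x * pow x n)             ∎

module FieldFacts {c ℓ : Level} (K : CommutativeRing c ℓ) where
  open CommutativeRing K hiding (zero)
  open Over K
  open RingArithmetic K
  open import Relation.Binary.Reasoning.Setoid setoid

  *-nonzero : IsField → ∀ {x y} → ¬ (x ≈ 0#) → ¬ (y ≈ 0#) → ¬ (x * y ≈ 0#)
  *-nonzero (_ , inverse) {x} {y} x≉0 y≉0 xy≈0 with inverse x x≉0
  ... | (x⁻¹ , xx⁻¹≈1) = y≉0 (begin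
    y                ≈⟨ *-identityˡ y ⟨
    1# * y           ≈⟨ *-congʳ xx⁻¹≈1 ⟨
    (x * x⁻¹) * y    ≈⟨ solve 3 (λ x y x⁻¹ → (x :* x⁻¹) :* y := x⁻¹ :* (x :* y)) refl x y x⁻¹ ⟩
    x⁻¹ * (x * y)    ≈⟨ *-congˡ xy≈0 ⟩
    x⁻¹ * 0#         ≈⟨ zeroʳ x⁻¹ ⟩
    0#               ∎)

  -‿nonzero : ∀ {x} → ¬ (x ≈ 0#) → ¬ (- x ≈ 0#)
  -‿nonzero {x} x≉0 -x≈0 = x≉0 (begin
    x       ≈⟨ solve 1 (λ x → x := :- (:- x)) refl x ⟩
    - (- x) ≈⟨ -‿cong -x≈0 ⟩
    - 0#    ≈⟨ solve 0 (:- con (+ 0) := con (+ 0)) refl ⟩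
    0#      ∎)

  sgn-nonzero : IsField → ∀ n → ¬ (sgn n ≈ 0#)
  sgn-nonzero (1≉0 , _) zero = 1≉0
  sgn-nonzero isField (suc n) = *-nonzero isField (-‿nonzero (proj₁ isField)) (sgn-nonzero isField n)

module TwoByTwo {c ℓ : Level} (K : CommutativeRing c ℓ) where
  open CommutativeRing K hiding (zero)
  open Over K
  open RingArithmetic K
  open FieldFacts K using (*-nonzero)
  open import Relation.Binary.Reasoning.Setoid setoid

  mat2 : Carrier → Carrier → Carrier → Carrier → Mat 2
  mat2 a b c e zero zero = a
  mat2 a b c e zero (suc zero) = b
  mat2 a b c e (suc zero) zero = c
  mat2 a b c e (suc zero) (suc zero) = e

  vec2 : Carrier → Carrier → Fin 2 → Carrier
  vec2 x y zero = x
  vec2 x y (suc zero) = y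

  ≈M-entries : ∀ {A B : Mat 2} →
    A zero zero ≈ B zero zero → A zero (suc zero) ≈ B zero (suc zero) →
    A (suc zero) zero ≈ B (suc zero) zero → A (suc zero) (suc zero) ≈ B (suc zero) (suc zero) →
    A ≈M B
  ≈M-entries e₀₀ e₀₁ e₁₀ e₁₁ zero zero = e₀₀
  ≈M-entries e₀₀ e₀₁ e₁₀ e₁₁ zero (suc zero) = e₀₁
  ≈M-entries e₀₀ e₀₁ e₁₀ e₁₁ (suc zero) zero = e₁₀
  ≈M-entries e₀₀ e₀₁ e₁₀ e₁₁ (suc zero) (suc zero) = e₁₁

  ⊗-entry : ∀ (A B : Mat 2) i j → (A ⊗ B) i j ≈ A i zero * B zero j + A i (suc zero) * B (suc zero) j
  ⊗-entry A B i j = +-congˡ (+-identityʳ _)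

  Diagonalizable-resp : ∀ {n} {M N : Mat n} → M ≈M N → Diagonalizable N → Diagonalizable M
  Diagonalizable-resp {n} M≈N (P , Q , d , PQ≈1 , QP≈1 , NP≈PD) =
    P , Q , d , PQ≈1 , QP≈1 , λ i j → trans (sumF-cong n (λ l → *-congʳ (M≈N i l))) (NP≈PD i j)
    where
    sumF-cong : ∀ n {f g : Fin n → Carrier} → (∀ i → f i ≈ g i) → sumF n f ≈ sumF n g
    sumF-cong zero f≈g = refl
    sumF-cong (suc n) f≈g = +-cong (f≈g zero) (sumF-cong n (λ i → f≈g (suc i)))

  IsEigenvector : Mat 2 → Carrier → Carrier → Carrier → Set ℓ
  IsEigenvector M θ x u =
    (M zero zero * x + M zero (suc zero) * u ≈ θ * x) × (M (suc zero) zero * x + M (suc zero) (suc zero) * u ≈ θ * u)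

  -- Over a field, two eigenvectors forming an invertible matrix P diagonalize M;
  -- the inverse of P is det⁻¹ · adj P.
  eigenbasis-diagonalizable : IsField → ∀ {M θ φ x u y w} →
    IsEigenvector M θ x u → IsEigenvector M φ y w → ¬ (x * w - y * u ≈ 0#) → Diagonalizable M
  eigenbasis-diagonalizable (_ , inverse) {M} {θ} {φ} {x} {u} {y} {w} (θx , θu) (φy , φw) det≉0
    with inverse (x * w - y * u) det≉0
  ... | (z , det·z≈1) = P , Q , vec2 θ φ , PQ≈1 , QP≈1 , MP≈PD
    where
    P Q : Mat 2
    P = mat2 x y u w
    Q = mat2 (z * w) (z * - y) (z * - u) (z * x)

    via-det : ∀ {a} → a ≈ (x * w - y * u) * z → a ≈ 1#
    via-det a≈ = trans a≈ det·z≈1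

    PQ≈1 : (P ⊗ Q) ≈M idM
    PQ≈1 = ≈M-entries
      (trans (⊗-entry P Q zero zero) (via-det (solve 5 (λ x y u w z → x :* (z :* w) :+ y :* (z :* (:- u)) := (x :* w :- y :* u) :* z) refl x y u w z)))
      (trans (⊗-entry P Q zero (suc zero)) (solve 5 (λ x y u w z → x :* (z :* (:- y)) :+ y :* (z :* x) := con (+ 0)) refl x y u w z))
      (trans (⊗-entry P Q (suc zero) zero) (solve 5 (λ x y u w z → u :* (z :* w) :+ w :* (z :* (:- u)) := con (+ 0)) refl x y u w z))
      (trans (⊗-entry P Q (suc zero) (suc zero)) (via-det (solve 5 (λ x y u w z → u :* (z :* (:- y)) :+ w :* (z :* x) := (x :* w :- y :* u) :* z) refl x y u w z)))

    QP≈1 : (Q ⊗ P) ≈M idM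
    QP≈1 = ≈M-entries
      (trans (⊗-entry Q P zero zero) (via-det (solve 5 (λ x y u w z → (z :* w) :* x :+ (z :* (:- y)) :* u := (x :* w :- y :* u) :* z) refl x y u w z)))
      (trans (⊗-entry Q P zero (suc zero)) (solve 5 (λ x y u w z → (z :* w) :* y :+ (z :* (:- y)) :* w := con (+ 0)) refl x y u w z))
      (trans (⊗-entry Q P (suc zero) zero) (solve 5 (λ x y u w z → (z :* (:- u)) :* x :+ (z :* x) :* u := con (+ 0)) refl x y u w z))
      (trans (⊗-entry Q P (suc zero) (suc zero)) (via-det (solve 5 (λ x y u w z → (z :* (:- u)) :* y :+ (z :* x) :* w := (x :* w :- y :* u) :* z) refl x y u w z)))

    -- column j of P ⊗ diag(θ, φ) is column j of P scaled by its eigenvalue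
    MP≈PD : (M ⊗ P) ≈M (P ⊗ diagM (vec2 θ φ))
    MP≈PD = ≈M-entries
      (trans (⊗-entry M P zero zero) (trans θx (solve 3 (λ x y θ → θ :* x := x :* (con (+ 1) :* θ) :+ (y :* (con (+ 0) :* θ) :+ con (+ 0))) refl x y θ)))
      (trans (⊗-entry M P zero (suc zero)) (trans φy (solve 3 (λ x y φ → φ :* y := x :* (con (+ 0) :* φ) :+ (y :* (con (+ 1) :* φ) :+ con (+ 0))) refl x y φ)))
      (trans (⊗-entry M P (suc zero) zero) (trans θu (solve 3 (λ u w θ → θ :* u := u :* (con (+ 1) :* θ) :+ (w :* (con (+ 0) :* θ) :+ con (+ 0))) refl u w θ)))
      (trans (⊗-entry M P (suc zero) (suc zero)) (trans φw (solve 3 (λ u w φ → φ :* w := u :* (con (+ 0) :* φ) :+ (w :* (con (+ 1) :* φ) :+ con (+ 0))) refl u w φ)))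

  -- (a + e)² - 4 (a e - b c), the discriminant of the characteristic polynomial
  discriminant : Carrier → Carrier → Carrier → Carrier → Carrier
  discriminant a b c e = (a - e) * (a - e) + castℤ (+ 4) * (b * c)

  -- The characteristic polynomial X² - (a + e) X + (a e - b c) of mat2 a b c e,
  -- as the list of its non-leading coefficients.
  charPoly : Carrier → Carrier → Carrier → Carrier → List Carrier
  charPoly a b c e = (a * e - b * c) ∷ - (a + e) ∷ []

  χ : ∀ {n} → Polynomial n → Polynomial n → Polynomial n → Polynomial n → Polynomial n → Polynomial n
  χ a b c e x = (a :* e :- b :* c) :+ x :* (:- (a :+ e) :+ x :* (con (+ 1) :+ x :* con (+ 0)))

  IsEigenvalue : Carrier → Carrier → Carrier → Carrier → Carrier → Set ℓ
  IsEigenvalue a b c e θ = evalP (charPoly a b c e ++ [ 1# ]) θ ≈ 0#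

  conjugate-eigenvalue : ∀ {a b c e θ} → IsEigenvalue a b c e θ → IsEigenvalue a b c e ((a + e) - θ)
  conjugate-eigenvalue {a} {b} {c} {e} {θ} χθ≈0 = trans
    (solve 5 (λ a b c e θ → χ a b c e ((a :+ e) :- θ) := χ a b c e θ) refl a b c e θ) χθ≈0

  eigenvalue-gap : ∀ {a b c e θ} → IsEigenvalue a b c e θ →
    (θ - ((a + e) - θ)) * (θ - ((a + e) - θ)) ≈ discriminant a b c e
  eigenvalue-gap {a} {b} {c} {e} {θ} χθ≈0 = begin
    (θ - ((a + e) - θ)) * (θ - ((a + e) - θ))  ≈⟨ solve 5 (λ a b c e θ →
         (θ :- ((a :+ e) :- θ)) :* (θ :- ((a :+ e) :- θ))
      := ((a :- e) :* (a :- e) :+ con (+ 4) :* (b :* c)) :+ con (+ 4) :* χ a b c e θ) refl a b c e θ ⟩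
    discriminant a b c e + castℤ (+ 4) * evalP (charPoly a b c e ++ [ 1# ]) θ ≈⟨ +-congˡ (trans (*-congˡ χθ≈0) (zeroʳ _)) ⟩
    discriminant a b c e + 0#                  ≈⟨ +-identityʳ _ ⟩
    discriminant a b c e                       ∎

  eigenvector-from-b : ∀ {a b c e θ} → IsEigenvalue a b c e θ → IsEigenvector (mat2 a b c e) θ b (θ - a)
  eigenvector-from-b {a} {b} {c} {e} {θ} χθ≈0 =
    solve 5 (λ a b c e θ → a :* b :+ b :* (θ :- a) := θ :* b) refl a b c e θ ,
    (begin
      c * b + e * (θ - a)                 ≈⟨ solve 5 (λ a b c e θ → c :* b :+ e :* (θ :- a) := θ :* (θ :- a) :- χ a b c e θ) refl a b c e θ ⟩
      θ * (θ - a) - evalP (charPoly a b c e ++ [ 1# ]) θ ≈⟨ +-congˡ (-‿cong χθ≈0) ⟩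
      θ * (θ - a) - 0#                    ≈⟨ solve 2 (λ θ a → θ :* (θ :- a) :- con (+ 0) := θ :* (θ :- a)) refl θ a ⟩
      θ * (θ - a)                         ∎)

  eigenvector-from-c : ∀ {a b c e θ} → IsEigenvalue a b c e θ → IsEigenvector (mat2 a b c e) θ (θ - e) c
  eigenvector-from-c {a} {b} {c} {e} {θ} χθ≈0 =
    (begin
      a * (θ - e) + b * c                 ≈⟨ solve 5 (λ a b c e θ → a :* (θ :- e) :+ b :* c := θ :* (θ :- e) :- χ a b c e θ) refl a b c e θ ⟩
      θ * (θ - e) - evalP (charPoly a b c e ++ [ 1# ]) θ ≈⟨ +-congˡ (-‿cong χθ≈0) ⟩
      θ * (θ - e) - 0#                    ≈⟨ solve 2 (λ θ e → θ :* (θ :- e) :- con (+ 0) := θ :* (θ :- e)) refl θ e ⟩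
      θ * (θ - e)                         ∎) ,
    solve 5 (λ a b c e θ → c :* (θ :- e) :+ e :* c := θ :* c) refl a b c e θ

  diagonal-diagonalizable : IsField → ∀ {a b c e} → b ≈ 0# → c ≈ 0# → Diagonalizable (mat2 a b c e)
  diagonal-diagonalizable isField {a} {b} {c} {e} b≈0 c≈0 =
    eigenbasis-diagonalizable isField {M = mat2 a b c e} {θ = a} {φ = e} {x = 1#} {u = 0#} {y = 0#} {w = 1#}
      (solve 2 (λ a b → a :* con (+ 1) :+ b :* con (+ 0) := a :* con (+ 1)) refl a b ,
       trans (+-cong (*-congʳ c≈0) (zeroʳ e)) (solve 1 (λ a → con (+ 0) :* con (+ 1) :+ con (+ 0) := a :* con (+ 0)) refl a))
      (trans (+-cong (zeroʳ a) (*-congʳ b≈0)) (solve 1 (λ e → con (+ 0) :+ con (+ 0) :* con (+ 1) := e :* con (+ 0)) refl e) ,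
       solve 2 (λ c e → c :* con (+ 0) :+ e :* con (+ 1) := e :* con (+ 1)) refl c e)
      (λ det≈0 → proj₁ isField (trans (solve 0 (con (+ 1) := con (+ 1) :* con (+ 1) :- con (+ 0) :* con (+ 0)) refl) det≈0))

  -- The eigenvectors are read
  -- off from a nonzero off-diagonal entry, so we need to know whether b or c vanishes.
  distinct-eigenvalues-diagonalizable : IsField → IsAlgClosed → ∀ {a b c e} →
    Dec (b ≈ 0#) → Dec (c ≈ 0#) → ¬ (discriminant a b c e ≈ 0#) → Diagonalizable (mat2 a b c e)
  distinct-eigenvalues-diagonalizable isField closed {a} {b} {c} {e} b≟0 c≟0 disc≉0
    with closed (charPoly a b c e) (ℕ.s≤s ℕ.z≤n)
  ... | (θ , χθ≈0) = by-cases b≟0 c≟0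
    where
    φ = (a + e) - θ
    χφ≈0 : IsEigenvalue a b c e φ
    χφ≈0 = conjugate-eigenvalue χθ≈0
    θ-φ≉0 : ¬ (θ - φ ≈ 0#)
    θ-φ≉0 θ-φ≈0 = disc≉0 (trans (sym (eigenvalue-gap χθ≈0)) (trans (*-congʳ θ-φ≈0) (zeroˡ _)))

    by-cases : Dec (b ≈ 0#) → Dec (c ≈ 0#) → Diagonalizable (mat2 a b c e)
    by-cases (no b≉0) _ = eigenbasis-diagonalizable isField {M = mat2 a b c e} (eigenvector-from-b χφ≈0) (eigenvector-from-b χθ≈0)
      (λ det≈0 → *-nonzero isField b≉0 θ-φ≉0
        (trans (solve 4 (λ b a θ φ → b :* (θ :- φ) := b :* (θ :- a) :- b :* (φ :- a)) refl b a θ φ) det≈0))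
    by-cases (yes _) (no c≉0) = eigenbasis-diagonalizable isField {M = mat2 a b c e} (eigenvector-from-c χθ≈0) (eigenvector-from-c χφ≈0)
      (λ det≈0 → *-nonzero isField c≉0 θ-φ≉0
        (trans (solve 4 (λ c e θ φ → c :* (θ :- φ) := (θ :- e) :* c :- (φ :- e) :* c) refl c e θ φ) det≈0))
    by-cases (yes b≈0) (yes c≈0) = diagonal-diagonalizable isField b≈0 c≈0

module Binomial where
  open import Data.Nat
  open import Data.Nat.Properties
  open import Data.Nat.Divisibility
  open import Data.Nat.Primality using (Prime; euclidsLemma; prime[2]; prime⇒nonZero)
  open import Data.Nat.Combinatorics using (_C_; nCk+nC[k+1]≡[n+1]C[k+1]; nC1≡n)
  open import Data.Sum using (_⊎_; inj₁; inj₂)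
  open import Data.Empty using (⊥-elim)
  open import Relation.Nullary using (¬_; yes; no)
  open import Relation.Binary.PropositionalEquality
  open +-*-Solver using (solve; _:+_; _:*_; _:=_; con)

  pascal : ∀ n k → suc n C suc k ≡ n C k + n C suc k
  pascal n k = sym (nCk+nC[k+1]≡[n+1]C[k+1] n k)

  absorption : ∀ n k → suc k * (suc n C suc k) ≡ suc n * (n C k)
  absorption zero zero = refl
  absorption zero (suc k) = *-zeroʳ (suc (suc k))
  absorption (suc n) zero = trans (*-identityˡ _) (trans (nC1≡n (suc (suc n))) (sym (*-identityʳ _)))
  absorption (suc n) (suc k) = begin
    suc (suc k) * (suc (suc n) C suc (suc k))
      ≡⟨ cong (suc (suc k) *_) (pascal (suc n) (suc k)) ⟩
    suc (suc k) * (X + Y)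
      ≡⟨ solve 3 (λ k x y → (con 2 :+ k) :* (x :+ y) := x :+ (con 1 :+ k) :* x :+ (con 2 :+ k) :* y) refl k X Y ⟩
    X + suc k * X + suc (suc k) * Y
      ≡⟨ cong₂ (λ u v → X + u + v) (absorption n k) (absorption n (suc k)) ⟩
    X + suc n * (n C k) + suc n * (n C suc k)
      ≡⟨ cong (λ u → u + suc n * (n C k) + suc n * (n C suc k)) (pascal n k) ⟩
    (n C k + n C suc k) + suc n * (n C k) + suc n * (n C suc k)
      ≡⟨ solve 3 (λ n a b → (a :+ b) :+ (con 1 :+ n) :* a :+ (con 1 :+ n) :* b := (con 2 :+ n) :* (a :+ b)) refl n (n C k) (n C suc k) ⟩
    suc (suc n) * (n C k + n C suc k)
      ≡⟨ cong (suc (suc n) *_) (pascal n k) ⟨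
    suc (suc n) * (suc n C suc k) ∎
    where
    open ≡-Reasoning
    X = suc n C suc k
    Y = suc n C suc (suc k)

  prime-power-cancel : ∀ {p} → Prime p → ∀ r i X → p ^ r ∣ i * X → ¬ p ∣ X → p ^ r ∣ i
  prime-power-cancel pr zero i X _ _ = 1∣ i
  prime-power-cancel {p} pr (suc r) i X p^r+1∣iX p∤X with euclidsLemma i X pr (∣-trans (m∣m*n (p ^ r)) p^r+1∣iX)
  ... | inj₂ p∣X = ⊥-elim (p∤X p∣X)
  ... | inj₁ (divides i′ refl) =
    subst (p * p ^ r ∣_) (*-comm p i′) (*-monoʳ-∣ p (prime-power-cancel pr r i′ X p^r∣i′X p∤X))
    where
    instance _ = prime⇒nonZero pr
    p^r∣i′X : p ^ r ∣ i′ * X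
    p^r∣i′X = *-cancelˡ-∣ p (subst (p * p ^ r ∣_) (solve 3 (λ i p X → i :* p :* X := p :* (i :* X)) refl i′ p X) p^r+1∣iX)

  prime-power-binomial : ∀ {p} → Prime p → ∀ r Q i → suc Q ≡ p ^ r → suc i < suc Q → p ∣ suc Q C suc i
  prime-power-binomial {p} pr r Q i q≡p^r i<Q with p ∣? (suc Q C suc i)
  ... | yes p∣C = p∣C
  ... | no p∤C = ⊥-elim (<⇒≱ i<Q (∣⇒≤ (subst (_∣ suc i) (sym q≡p^r) q∣i)))
    where
    q∣iC : p ^ r ∣ suc i * (suc Q C suc i)
    q∣iC = subst (_∣ suc i * (suc Q C suc i)) q≡p^r
             (divides (Q C i) (trans (absorption Q i) (*-comm (suc Q) (Q C i))))
    q∣i : p ^ r ∣ suc i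
    q∣i = prime-power-cancel pr r (suc i) (suc Q C suc i) q∣iC p∤C

  even-or-succ-even : ∀ n → 2 ∣ n ⊎ 2 ∣ suc n
  even-or-succ-even zero = inj₁ (2 ∣0)
  even-or-succ-even (suc n) with even-or-succ-even n
  ... | inj₁ (divides d n≡d*2) = inj₂ (divides (suc d) (cong (λ x → 2 + x) n≡d*2))
  ... | inj₂ 2∣n+1 = inj₁ 2∣n+1

  not-both-even : ∀ n → 2 ∣ n → ¬ 2 ∣ suc n
  not-both-even n 2∣n 2∣n+1 with ∣1⇒≡1 (∣m+n∣m⇒∣n (subst (2 ∣_) (+-comm 1 n) 2∣n+1) 2∣n)
  ... | ()

  absorption′ : ∀ m j → suc j * (m C suc j) + suc j * (m C j) ≡ suc m * (m C j)
  absorption′ m j = begin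
    suc j * (m C suc j) + suc j * (m C j) ≡⟨ *-distribˡ-+ (suc j) (m C suc j) (m C j) ⟨
    suc j * (m C suc j + m C j)           ≡⟨ cong (suc j *_) (trans (pascal m j) (+-comm (m C j) (m C suc j))) ⟨
    suc j * (suc m C suc j)               ≡⟨ absorption m j ⟩
    suc m * (m C j)                       ∎
    where open ≡-Reasoning

  -- A case of Lucas' theorem mod 2: when m + j + 1 is even, C(m, j) ≡ C(m, j+1) mod 2.
  -- We need the direction: if C(m, j+1) is even then so is C(m, j).
  even-binomial : ∀ m j → 2 ∣ m + suc j → 2 ∣ m C suc j → 2 ∣ m C j
  even-binomial m j 2∣m+j+1 2∣C′ with even-or-succ-even (suc j)
  ... | inj₁ 2∣j+1 with euclidsLemma (suc m) (m C j) prime[2] 2∣[m+1]C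
    where
    2∣[m+1]C : 2 ∣ suc m * (m C j)
    2∣[m+1]C = subst (2 ∣_) (absorption′ m j) (∣m∣n⇒∣m+n (∣m⇒∣m*n (m C suc j) 2∣j+1) (∣m⇒∣m*n (m C j) 2∣j+1))
  ...   | inj₁ 2∣m+1 = ⊥-elim (not-both-even m (∣m+n∣m⇒∣n (subst (2 ∣_) (+-comm m (suc j)) 2∣m+j+1) 2∣j+1) 2∣m+1)
  ...   | inj₂ 2∣C = 2∣C
  even-binomial m j 2∣m+j+1 2∣C′ | inj₂ 2∣j+2 with euclidsLemma (suc j) (m C j) prime[2] 2∣[j+1]C
    where
    2∣m+1 : 2 ∣ suc m
    2∣m+1 with even-or-succ-even m
    ... | inj₁ 2∣m = ⊥-elim (not-both-even (suc j) (∣m+n∣m⇒∣n 2∣m+j+1 2∣m) 2∣j+2)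
    ... | inj₂ 2∣m+1 = 2∣m+1
    2∣[j+1]C : 2 ∣ suc j * (m C j)
    2∣[j+1]C = ∣m+n∣m⇒∣n (subst (2 ∣_) (sym (absorption′ m j)) (∣m⇒∣m*n (m C j) 2∣m+1)) (∣n⇒∣m*n (suc j) 2∣C′)
  ...   | inj₁ 2∣j+1 = ⊥-elim (not-both-even (suc j) 2∣j+1 2∣j+2)
  ...   | inj₂ 2∣C = 2∣C

module PrimePowers {p : ℕ} (pr : Prime p) where
  open import Data.Nat
  open import Data.Nat.Properties using (*-mono-≤; m^n>0)
  open import Data.Nat.Divisibility using (_∣_; ∣1⇒≡1; m∣m*n)
  open import Data.Nat.Primality using (prime⇒nonZero; prime⇒nonTrivial; irreducible[2]; ¬prime[1])
  open import Relation.Binary.PropositionalEquality using (_≡_; refl)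

  prime∣2⇒≡2 : p ∣ 2 → p ≡ 2
  prime∣2⇒≡2 p∣2 with irreducible[2] p∣2
  ... | inj₁ refl = ⊥-elim (¬prime[1] pr)
  ... | inj₂ p≡2 = p≡2

  prime∤1 : ¬ p ∣ 1
  prime∤1 p∣1 with ∣1⇒≡1 p∣1
  ... | refl = ¬prime[1] pr

  prime∣power : ∀ r → 1 ≤ r → p ∣ p ^ r
  prime∣power (suc r) _ = m∣m*n (p ^ r)

  prime-power≥2 : ∀ r → 1 ≤ r → 2 ≤ p ^ r
  prime-power≥2 (suc r) _ = *-mono-≤ (nonTrivial⇒n>1 p {{prime⇒nonTrivial pr}}) (m^n>0 p {{prime⇒nonZero pr}} r)

module PrimeCharacteristic {c ℓ : Level} (K : CommutativeRing c ℓ) {p : ℕ} (pr : Prime p) (char : Over.HasChar K p) where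
  open CommutativeRing K hiding (zero)
  open Over K
  open RingArithmetic K
  open Binomial
  open import Relation.Binary.Reasoning.Setoid setoid

  castℕ-∣ : ∀ {a} → p ∣ a → castℕ a ≈ 0#
  castℕ-∣ (divides d P.refl) = trans (castℕ-* d p) (trans (*-congˡ char) (zeroʳ _))

  castℕ-pascal : ∀ n k → castℕ (suc n C suc k) ≈ castℕ (n C k) + castℕ (n C suc k)
  castℕ-pascal n k = trans (reflexive (P.cong castℕ (pascal n k))) (castℕ-+ (n C k) (n C suc k))

  sgn-castℕ : ∀ n → sgn n ≈ castℕ ((p ℕ.∸ 1) ℕ.^ n)
  sgn-castℕ zero = sym (+-identityʳ 1#)
  sgn-castℕ (suc n) = trans (*-cong minus-one (sgn-castℕ n)) (sym (castℕ-* (p ℕ.∸ 1) _))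
    where
    p≡1+[p-1] : p ≡ suc (p ℕ.∸ 1)
    p≡1+[p-1] = P.sym (ℕP.suc-pred p {{prime⇒nonZero pr}})
    minus-one : - 1# ≈ castℕ (p ℕ.∸ 1)
    minus-one = begin
      - 1#                                      ≈⟨ solve 1 (λ x → :- con (+ 1) := x :- (con (+ 1) :+ x)) refl (castℕ (p ℕ.∸ 1)) ⟩
      castℕ (p ℕ.∸ 1) - (1# + castℕ (p ℕ.∸ 1))  ≈⟨ +-congˡ (-‿cong (trans (reflexive (P.cong castℕ (P.sym p≡1+[p-1]))) char)) ⟩
      castℕ (p ℕ.∸ 1) - 0#                      ≈⟨ solve 1 (λ x → x :- con (+ 0) := x) refl (castℕ (p ℕ.∸ 1)) ⟩
      castℕ (p ℕ.∸ 1)                           ∎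

  module PrimePower (r Q : ℕ) (q≡p^r : suc Q ≡ p ℕ.^ r) where

    binomial-q-vanishes : ∀ i → suc i < suc Q → castℕ (suc Q C suc i) ≈ 0#
    binomial-q-vanishes i i<Q = castℕ-∣ (prime-power-binomial pr r Q i q≡p^r i<Q)

    -- Lucas-type shifts, from (1 + X)^(m+q) = (1 + X)^m (1 + X^q) in K[X]:
    -- C(m + q, j) ≡ C(m, j) for j < q, and C(m + q, i + q) ≡ C(m, i + q) + C(m, i) for i < q.
    shift-below : ∀ m j → j < suc Q → castℕ ((m ℕ.+ suc Q) C j) ≈ castℕ (m C j)
    shift-below m zero _ = refl
    shift-below zero (suc i) i<Q = binomial-q-vanishes i i<Q
    shift-below (suc m) (suc i) i<Q = begin
      castℕ (suc (m ℕ.+ suc Q) C suc i)                        ≈⟨ castℕ-pascal (m ℕ.+ suc Q) i ⟩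
      castℕ ((m ℕ.+ suc Q) C i) + castℕ ((m ℕ.+ suc Q) C suc i) ≈⟨ +-cong (shift-below m i (ℕP.<-trans (ℕP.n<1+n i) i<Q)) (shift-below m (suc i) i<Q) ⟩
      castℕ (m C i) + castℕ (m C suc i)                         ≈⟨ castℕ-pascal m i ⟨
      castℕ (suc m C suc i)                                     ∎

    shift-above : ∀ m i → i < suc Q → castℕ ((m ℕ.+ suc Q) C (i ℕ.+ suc Q)) ≈ castℕ (m C (i ℕ.+ suc Q)) + castℕ (m C i)
    shift-above zero zero _ = trans (reflexive (P.cong castℕ (nCn≡1 (suc Q)))) (sym (+-identityˡ _))
    shift-above zero (suc i) _ =
      trans (reflexive (P.cong castℕ (k>n⇒nCk≡0 (s≤s (ℕP.m≤n+m (suc Q) i))))) (sym (+-identityˡ 0#))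
    shift-above (suc m) zero _ = begin
      castℕ (suc (m ℕ.+ suc Q) C suc Q)                              ≈⟨ castℕ-pascal (m ℕ.+ suc Q) Q ⟩
      castℕ ((m ℕ.+ suc Q) C Q) + castℕ ((m ℕ.+ suc Q) C suc Q)       ≈⟨ +-cong (shift-below m Q (ℕP.n<1+n Q)) (shift-above m zero (s≤s ℕ.z≤n)) ⟩
      castℕ (m C Q) + (castℕ (m C suc Q) + castℕ (m C 0))            ≈⟨ +-assoc _ _ _ ⟨
      (castℕ (m C Q) + castℕ (m C suc Q)) + castℕ (m C 0)            ≈⟨ +-congʳ (castℕ-pascal m Q) ⟨
      castℕ (suc m C suc Q) + castℕ (suc m C 0)                      ∎
    shift-above (suc m) (suc i) i<Q = begin
      castℕ (suc (m ℕ.+ suc Q) C suc (i ℕ.+ suc Q))                  ≈⟨ castℕ-pascal (m ℕ.+ suc Q) (i ℕ.+ suc Q) ⟩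
      castℕ ((m ℕ.+ suc Q) C (i ℕ.+ suc Q)) + castℕ ((m ℕ.+ suc Q) C (suc i ℕ.+ suc Q))
        ≈⟨ +-cong (shift-above m i (ℕP.<-trans (ℕP.n<1+n i) i<Q)) (shift-above m (suc i) i<Q) ⟩
      (x + y) + (z + w)                                                ≈⟨ solve 4 (λ a b c d → (a :+ b) :+ (c :+ d) := (a :+ c) :+ (b :+ d)) refl x y z w ⟩
      (x + z) + (y + w)                                                ≈⟨ +-cong (castℕ-pascal m (i ℕ.+ suc Q)) (castℕ-pascal m i) ⟨
      castℕ (suc m C suc (i ℕ.+ suc Q)) + castℕ (suc m C suc i)       ∎
      where
      x = castℕ (m C (i ℕ.+ suc Q))
      y = castℕ (m C i)
      z = castℕ (m C suc (i ℕ.+ suc Q))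
      w = castℕ (m C suc i)

    -- C(q - 1, j) ≡ (-1)^j, since C(q-1, j) + C(q-1, j+1) = C(q, j+1) ≡ 0.
    binomial-q-1 : ∀ j → j ≤ Q → castℕ (Q C j) ≈ sgn j
    binomial-q-1 zero _ = +-identityʳ 1#
    binomial-q-1 (suc j) j<Q = begin
      castℕ (Q C suc j)                                  ≈⟨ solve 2 (λ x y → y := :- x :+ (x :+ y)) refl (castℕ (Q C j)) (castℕ (Q C suc j)) ⟩
      - castℕ (Q C j) + (castℕ (Q C j) + castℕ (Q C suc j)) ≈⟨ +-congˡ (castℕ-pascal Q j) ⟨
      - castℕ (Q C j) + castℕ (suc Q C suc j)           ≈⟨ +-cong (-‿cong (binomial-q-1 j (ℕP.<⇒≤ j<Q))) (binomial-q-vanishes j (s≤s j<Q)) ⟩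
      - sgn j + 0#                                      ≈⟨ solve 1 (λ s → :- s :+ con (+ 0) := :- con (+ 1) :* s) refl (sgn j) ⟩
      sgn (suc j)                                       ∎

module TranscendentalElement {c ℓ : Level} (K : CommutativeRing c ℓ) (isField : Over.IsField K)
  {p : ℕ} (pr : Prime p) (char : Over.HasChar K p)
  (t : CommutativeRing.Carrier K) (transcendental : Over.Transcendental K p t) where
  open CommutativeRing K hiding (zero)
  open Over K
  open RingArithmetic K
  open FieldFacts K using (*-nonzero; -‿nonzero)
  open PrimeCharacteristic K pr char using (castℕ-∣)
  open import Algebra.Properties.Ring ring using (-0#≈0#)
  open import Relation.Binary.Reasoning.Setoid setoid

  castℕ-nonzero : ∀ {a} → ¬ p ∣ a → ¬ (castℕ a ≈ 0#)
  castℕ-nonzero {a} p∤a a≈0 =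
    transcendental (a ∷ []) (here p∤a) (trans (+-cong a≈0 (zeroʳ t)) (+-identityʳ 0#))

  castℕ≈0⇒∣ : ∀ {a} → castℕ a ≈ 0# → p ∣ a
  castℕ≈0⇒∣ {a} a≈0 with p ∣? a
  ... | yes p∣a = p∣a
  ... | no p∤a = ⊥-elim (castℕ-nonzero p∤a a≈0)

  pow-t-nonzero : ∀ n → ¬ (pow t n ≈ 0#)
  pow-t-nonzero zero = proj₁ isField
  pow-t-nonzero (suc n) = *-nonzero isField t-nonzero (pow-t-nonzero n)
    where
    t-nonzero : ¬ (t ≈ 0#)
    t-nonzero t≈0 = transcendental (0 ∷ 1 ∷ []) (there (here (PrimePowers.prime∤1 pr)))
      (trans (+-identityˡ _) (trans (*-congʳ t≈0) (zeroˡ _)))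

  -- X + t^(m+1) Y ≠ 0 in K when p ∤ X: it is a nonzero polynomial in t over F_p.
  X+tY-nonzero : ∀ {X} → ¬ p ∣ X → ∀ m Y → ¬ (castℕ X + pow t (suc m) * castℕ Y ≈ 0#)
  X+tY-nonzero {X} p∤X m Y X+tY≈0 = transcendental (X ∷ monomial m) (here p∤X)
    (trans (+-congˡ (trans (*-congˡ (eval-monomial m)) (sym (*-assoc _ _ _)))) X+tY≈0)
    where
    monomial : ℕ → List ℕ
    monomial zero = Y ∷ []
    monomial (suc m) = 0 ∷ monomial m
    eval-monomial : ∀ m → evalP (map castℕ (monomial m)) t ≈ pow t m * castℕ Y
    eval-monomial zero = solve 2 (λ t y → y :+ t :* con (+ 0) := con (+ 1) :* y) refl t (castℕ Y)
    eval-monomial (suc m) = trans (+-congˡ (*-congˡ (eval-monomial m)))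
      (solve 3 (λ t q y → con (+ 0) :+ t :* (q :* y) := (t :* q) :* y) refl t (pow t m) (castℕ Y))

  -tᵐN≈0? : ∀ {x} m N → x ≈ - (pow t m * castℕ N) → Dec (x ≈ 0#)
  -tᵐN≈0? {x} m N x≈ with p ∣? N
  ... | yes p∣N = yes (trans x≈ (trans (-‿cong (trans (*-congˡ (castℕ-∣ p∣N)) (zeroʳ _))) -0#≈0#))
  ... | no p∤N = no (λ x≈0 → -‿nonzero (*-nonzero isField (pow-t-nonzero m) (castℕ-nonzero p∤N)) (trans (sym x≈) x≈0))

-- The class C_j = {ℓ ≤ k - 2 : ℓ ≡ j (mod D)} for D = q - 1 = e + 1 and j < D:
-- its elements are j, j + D, j + 2D, ..., and it has exactly two of them
-- iff j + D ≤ k - 2 < j + 2D.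
module ResidueClass (e j : ℕ) (j<D : j < suc e) where
  open import Data.Nat
  open import Data.Nat.Properties
  open import Data.Nat.DivMod using (_%_; _/_; m≡m%n+[m/n]*n; [m+kn]%n≡m%n; m%n<n; m<n⇒m%n≡m)
  open import Data.Nat.Divisibility using (_∣_; ∣m+n∣m⇒∣n; n∣m*n; ∣⇒≤)
  open import Data.List using (List; []; _∷_; _++_; [_]; length; filter; upTo; map)
  open import Data.List.Properties using (upTo-∷ʳ; filter-++; filter-accept; filter-reject; ++-identityʳ; map-++; length-map; length-upTo)
  open import Data.Product using (Σ; _×_; _,_)
  open import Data.Empty using (⊥-elim)
  open import Relation.Nullary using (¬_; yes; no)
  open import Relation.Binary.PropositionalEquality hiding ([_])
  open +-*-Solver using (solve; _:+_; _:*_; _:=_; con)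

  D : ℕ
  D = suc e

  InClass : ℕ → Set
  InClass x = x % D ≡ j % D

  below : ℕ → List ℕ
  below m = Cls (suc (suc e)) (suc m) j

  below-suc : ∀ m → below (suc m) ≡ below m ++ filter (λ x → x % D ≟ j % D) [ m ]
  below-suc m = trans (cong (filter (λ x → x % D ≟ j % D)) (sym (upTo-∷ʳ m))) (filter-++ _ (upTo m) [ m ])

  below-add : ∀ x → InClass x → below (suc x) ≡ below x ++ [ x ]
  below-add x x∈C = trans (below-suc x) (cong (below x ++_) (filter-accept (λ x → x % D ≟ j % D) {x} {[]} x∈C))

  below-skip : ∀ a n → (∀ y → y < n → ¬ InClass (a + y)) → below (a + n) ≡ below a
  below-skip a zero _ = cong below (+-identityʳ a)
  below-skip a (suc n) gap = begin
    below (a + suc n)     ≡⟨ cong below (+-suc a n) ⟩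
    below (suc (a + n))   ≡⟨ below-suc (a + n) ⟩
    below (a + n) ++ filter (λ x → x % D ≟ j % D) [ a + n ]
      ≡⟨ cong (below (a + n) ++_) (filter-reject (λ x → x % D ≟ j % D) {a + n} {[]} (gap n (n<1+n n))) ⟩
    below (a + n) ++ []   ≡⟨ ++-identityʳ _ ⟩
    below (a + n)         ≡⟨ below-skip a n (λ y y<n → gap y (m<n⇒m<1+n y<n)) ⟩
    below a               ∎
    where open ≡-Reasoning

  member-form : ∀ x → InClass x → x ≡ j + (x / D) * D
  member-form x x∈C = trans (m≡m%n+[m/n]*n x D) (cong (_+ (x / D) * D) (trans x∈C (m<n⇒m%n≡m j<D)))

  member : ∀ c → InClass (j + c * D)
  member c = [m+kn]%n≡m%n j c D

  nothing-below-j : ∀ y → y < j → ¬ InClass y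
  nothing-below-j y y<j y∈C = <⇒≱ y<j (≤-trans (m≤m+n j _) (≤-reflexive (sym (member-form y y∈C))))

  -- Between two consecutive members j + c D and j + (c+1) D there are no others:
  -- such an x = j + c D + (1 + y) would give D ∣ 1 + y with 1 + y < D.
  nothing-between : ∀ c y → y < e → ¬ InClass (suc (j + c * D) + y)
  nothing-between c y y<e x∈C = <⇒≱ (s≤s y<e) (∣⇒≤ D∣1+y)
    where
    x = suc (j + c * D) + y
    x≡ : j + (c * D + suc y) ≡ j + (x / D) * D
    x≡ = trans (solve 4 (λ j c d y → j :+ (c :* d :+ (con 1 :+ y)) := con 1 :+ (j :+ c :* d) :+ y) refl j c D y) (member-form x x∈C)
    D∣1+y : D ∣ suc y
    D∣1+y = ∣m+n∣m⇒∣n (subst (D ∣_) (sym (+-cancelˡ-≡ j _ _ x≡)) (n∣m*n (x / D))) (n∣m*n c)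

  member-at : ℕ → ℕ
  member-at c = j + c * D

  map-upTo-suc : ∀ c → map member-at (upTo (suc c)) ≡ map member-at (upTo c) ++ [ member-at c ]
  map-upTo-suc c = trans (cong (map member-at) (sym (upTo-∷ʳ c))) (map-++ member-at (upTo c) [ c ])

  members-below : ∀ c → below (j + c * D) ≡ map member-at (upTo c)
  members-after : ∀ c y → y ≤ e → below (suc (j + c * D) + y) ≡ map member-at (upTo (suc c))

  members-below zero = trans (cong below (+-identityʳ j)) (below-skip 0 j nothing-below-j)
  members-below (suc c) = trans (cong below j+[c+1]D≡) (members-after c e ≤-refl)
    where
    j+[c+1]D≡ : j + suc c * D ≡ suc (j + c * D) + e
    j+[c+1]D≡ = solve 3 (λ j c e → j :+ (con 1 :+ c) :* (con 1 :+ e) := con 1 :+ (j :+ c :* (con 1 :+ e)) :+ e) refl j c e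

  members-after c y y≤e = begin
    below (suc (j + c * D) + y)             ≡⟨ below-skip (suc (j + c * D)) y (λ z z<y → nothing-between c z (<-≤-trans z<y y≤e)) ⟩
    below (suc (j + c * D))                 ≡⟨ below-add (j + c * D) (member c) ⟩
    below (j + c * D) ++ [ member-at c ]     ≡⟨ cong (_++ [ member-at c ]) (members-below c) ⟩
    map member-at (upTo c) ++ [ member-at c ] ≡⟨ map-upTo-suc c ⟨
    map member-at (upTo (suc c))            ∎
    where open ≡-Reasoning

  two-members : ∀ m → length (below m) ≡ 2 →
    Σ ℕ λ n → n < D × m ≡ suc (j + D + n) × below m ≡ j ∷ j + D ∷ []
  two-members m length≡2 with m ≤? j
  ... | yes m≤j = ⊥-elim (0≢1+n (trans (cong length (sym below≡[])) length≡2))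
    where
    below≡[] : below m ≡ []
    below≡[] = below-skip 0 m (λ y y<m → nothing-below-j y (<-≤-trans y<m m≤j))
  ... | no m≰j = y , m%n<n r D , m≡ , members
    where
    r = m ∸ suc j
    c = r / D
    y = r % D
    m≡′ : m ≡ suc (j + c * D) + y
    m≡′ = begin
      m                       ≡⟨ m+[n∸m]≡n (≰⇒> m≰j) ⟨
      suc j + r               ≡⟨ cong (λ x → suc j + x) (m≡m%n+[m/n]*n r D) ⟩
      suc j + (y + c * D)     ≡⟨ solve 4 (λ j y c d → con 1 :+ j :+ (y :+ c :* d) := con 1 :+ (j :+ c :* d) :+ y) refl j y c D ⟩
      suc (j + c * D) + y     ∎
      where open ≡-Reasoning
    below-m : below m ≡ map member-at (upTo (suc c))
    below-m = trans (cong below m≡′) (members-after c y (≤-pred (m%n<n r D)))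
    c≡1 : c ≡ 1
    c≡1 = suc-injective (trans (sym (trans (length-map member-at (upTo (suc c))) (length-upTo (suc c))))
                               (trans (cong length (sym below-m)) length≡2))
    m≡ : m ≡ suc (j + D + y)
    m≡ = trans m≡′ (cong (λ z → suc (j + z) + y) (trans (cong (_* D) c≡1) (*-identityˡ D)))
    members : below m ≡ j ∷ j + D ∷ []
    members = trans below-m (subst (λ z → map member-at (upTo (suc z)) ≡ j ∷ j + D ∷ []) (sym c≡1)
                (cong₂ (λ u v → u ∷ v ∷ []) (+-identityʳ j) (cong (λ x → j + x) (+-identityʳ D))))

comparisons : ∀ j e → ((j ℕ.+ suc e ≡ᵇ j) ≡ false) × ((j ≡ᵇ j ℕ.+ suc e) ≡ false)
                    × ((j <ᵇ j ℕ.+ suc e) ≡ true) × ((j ℕ.+ suc e <ᵇ j) ≡ false)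
comparisons zero e = P.refl , P.refl , P.refl , P.refl
comparisons (suc j) e = comparisons j e

≡ᵇ-refl : ∀ n → (n ≡ᵇ n) ≡ true
≡ᵇ-refl zero = P.refl
≡ᵇ-refl (suc n) = ≡ᵇ-refl n

[a+b]-a : ∀ a b → + (a ℕ.+ b) ℤ.- + a ≡ + b
[a+b]-a a b = P.trans (ℤP.[+m]-[+n]≡m⊖n (a ℕ.+ b) a)
                (P.trans (ℤP.⊖-≥ (ℕP.m≤m+n a b)) (P.cong +_ (ℕP.m+n∸m≡n a b)))

module AtkinMatrix {c ℓ : Level} (K : CommutativeRing c ℓ) (t : CommutativeRing.Carrier K) (e j n : ℕ) where
  open CommutativeRing K hiding (zero)
  open Over K
  open RingArithmetic K
  open import Relation.Binary.Reasoning.Setoid setoid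

  D q k : ℕ
  D = suc e
  q = suc D
  k = suc (suc (j ℕ.+ D ℕ.+ n))

  -- the matrix of U_t on the span of the c_ℓ, ℓ ∈ L (so Mj t q k j = UMatrix (Cls q k j))
  UMatrix : (L : List ℕ) → Mat (length L)
  UMatrix L a b = Ucoef t q k (lookup L b) (lookup L a)

  diagCoef-at : ∀ J N → (+ k ℤ.- + 2) ℤ.- + J ≡ + N → diagCoef t q k J ≡ - (pow (- t) (suc J) * castℕ (N C J))
  diagCoef-at J N eq = P.cong (λ z → - (pow (- t) (suc J) * binK z (+ J))) eq

  offCoef-at : ∀ J h N M → (+ k ℤ.- + 2) ℤ.- + J ℤ.- h ℤ.* + D ≡ + N → ℤ.- (h ℤ.* + D) ≡ M →
    offCoef t q k J h ≡ - (pow t (suc J) * (binK (+ N) M + sgn (suc J) * castℕ (N C J)))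
  offCoef-at J h N M eqN eqM = P.cong₂ (λ z w → - (pow t (suc J) * (binK z w + sgn (suc J) * binK z (+ J)))) eqN eqM

  a₀₀ a₀₁ a₁₀ : Carrier
  a₀₀ = - (pow (- t) (suc j) * castℕ ((D ℕ.+ n) C j))
  a₀₁ = - (pow t (suc (j ℕ.+ D)) * (castℕ ((n ℕ.+ D) C D) + sgn (suc (j ℕ.+ D)) * castℕ ((n ℕ.+ D) C (j ℕ.+ D))))
  a₁₀ = - (pow t (suc j) * (0# + sgn (suc j) * castℕ (n C j)))

  private
    k-2-j≡ : (+ k ℤ.- + 2) ℤ.- + j ≡ + (D ℕ.+ n)
    k-2-j≡ = P.trans (P.cong (λ z → + z ℤ.- + j) (ℕP.+-assoc j D n)) ([a+b]-a j (D ℕ.+ n))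

    k-2-[j+D]≡ : (+ k ℤ.- + 2) ℤ.- + (j ℕ.+ D) ≡ + n
    k-2-[j+D]≡ = [a+b]-a (j ℕ.+ D) n

    [j+D-j]/D : (j ℕ.+ D ℕ.∸ j) / D ≡ 1
    [j+D-j]/D = P.trans (P.cong (_/ D) (ℕP.m+n∸m≡n j D)) (n/n≡1 D)

  entry₀₀ : UMatrix (j ∷ j ℕ.+ D ∷ []) zero zero ≡ a₀₀
  entry₀₀ rewrite ≡ᵇ-refl j = diagCoef-at j (D ℕ.+ n) k-2-j≡

  entry₁₁ : n < D → UMatrix (j ∷ j ℕ.+ D ∷ []) (suc zero) (suc zero) ≈ 0#
  entry₁₁ n<D rewrite ≡ᵇ-refl (j ℕ.+ D) = begin
    diagCoef t q k (j ℕ.+ D)                                 ≡⟨ diagCoef-at (j ℕ.+ D) n k-2-[j+D]≡ ⟩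
    - (pow (- t) (suc (j ℕ.+ D)) * castℕ (n C (j ℕ.+ D)))  ≡⟨ P.cong (λ z → - (pow (- t) (suc (j ℕ.+ D)) * castℕ z)) n<j+D ⟩
    - (pow (- t) (suc (j ℕ.+ D)) * 0#)                      ≈⟨ solve 1 (λ x → :- (x :* con (+ 0)) := con (+ 0)) refl _ ⟩
    0#                                                       ∎
    where
    n<j+D : n C (j ℕ.+ D) ≡ 0
    n<j+D = k>n⇒nCk≡0 (ℕP.<-≤-trans n<D (ℕP.m≤n+m D j))

  entry₁₀ : UMatrix (j ∷ j ℕ.+ D ∷ []) (suc zero) zero ≡ a₁₀
  entry₁₀ rewrite proj₁ (comparisons j e) | proj₁ (proj₂ (proj₂ (comparisons j e))) | [j+D-j]/D =
    offCoef-at j (+ 1) n -[1+ e ]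
      (P.trans (P.cong₂ ℤ._-_ k-2-j≡ (ℤP.*-identityˡ (+ D))) ([a+b]-a D n))
      (P.cong ℤ.-_ (ℤP.*-identityˡ (+ D)))

  entry₀₁ : UMatrix (j ∷ j ℕ.+ D ∷ []) zero (suc zero) ≡ a₀₁
  entry₀₁ rewrite proj₁ (proj₂ (comparisons j e)) | proj₂ (proj₂ (proj₂ (comparisons j e))) | [j+D-j]/D =
    offCoef-at (j ℕ.+ D) -[1+ 0 ] (n ℕ.+ D) (+ D)
      (P.trans (P.cong₂ ℤ._-_ k-2-[j+D]≡ (ℤP.-1*i≡-i (+ D))) (P.cong (λ z → (+ n) ℤ.+ z) (ℤP.neg-involutive (+ D))))
      (P.trans (P.cong ℤ.-_ (ℤP.-1*i≡-i (+ D))) (ℤP.neg-involutive (+ D)))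

k-split : ∀ i D m → suc (suc (suc i ℕ.+ D ℕ.+ suc m)) ≡ (suc D ℕ.+ 2) ℕ.+ (m ℕ.+ suc i)
k-split = solve 3 (λ i d m → con 2 :+ ((con 1 :+ i :+ d) :+ (con 1 :+ m)) := (con 1 :+ d :+ con 2) :+ (m :+ (con 1 :+ i))) P.refl
  where open +-*-Solver using (solve; _:+_; _:=_; con)

module TwoElementClass {c ℓ : Level} (K : CommutativeRing c ℓ)
  (isField : Over.IsField K) (closed : Over.IsAlgClosed K)
  {p : ℕ} (pr : Prime p) (char : Over.HasChar K p)
  (t : CommutativeRing.Carrier K) (transcendental : Over.Transcendental K p t)
  (r : ℕ) (1≤r : 1 ≤ r) (e : ℕ) (q≡p^r : suc (suc e) ≡ p ℕ.^ r) where
  open CommutativeRing K hiding (zero)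
  open Over K
  open RingArithmetic K
  open FieldFacts K
  open TwoByTwo K
  open PrimeCharacteristic K pr char
  open PrimePower r (suc e) q≡p^r
  open TranscendentalElement K isField pr char t transcendental
  open PrimePowers pr
  open Binomial using (even-binomial)
  open import Algebra.Properties.Ring ring using (-0#≈0#)
  open import Relation.Binary.Reasoning.Setoid setoid

  D : ℕ
  D = suc e

  module Entries (j n : ℕ) = AtkinMatrix K t e j n
  open Entries using (a₀₀; a₀₁; a₁₀)

  p∣q : p ∣ suc D
  p∣q = P.subst (p ∣_) (P.sym q≡p^r) (prime∣power r 1≤r)

  Pair : ℕ → ℕ → Mat 2
  Pair j n = mat2 (a₀₀ j n) (a₀₁ j n) (a₁₀ j n) 0#

  -- Case p ∤ C(D + n, j): the discriminant is t^(2j+2) (A² + 4 t^D B C) with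
  -- A, B, C natural numbers and p ∤ A, a nonzero polynomial in t.
  module UnitCase (j n : ℕ) where
    A B C′ : ℕ
    A = (D ℕ.+ n) C j
    B = (n ℕ.+ D) C D ℕ.+ (p ℕ.∸ 1) ℕ.^ suc (j ℕ.+ D) ℕ.* ((n ℕ.+ D) C (j ℕ.+ D))
    C′ = (p ℕ.∸ 1) ℕ.^ suc j ℕ.* (n C j)

    T : Carrier
    T = pow t (suc j)

    a₀₁≈ : a₀₁ j n ≈ - (pow t (suc (j ℕ.+ D)) * castℕ B)
    a₀₁≈ = -‿cong (*-congˡ (begin
      castℕ ((n ℕ.+ D) C D) + sgn (suc (j ℕ.+ D)) * castℕ ((n ℕ.+ D) C (j ℕ.+ D))
        ≈⟨ +-congˡ (*-congʳ (sgn-castℕ (suc (j ℕ.+ D)))) ⟩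
      castℕ ((n ℕ.+ D) C D) + castℕ ((p ℕ.∸ 1) ℕ.^ suc (j ℕ.+ D)) * castℕ ((n ℕ.+ D) C (j ℕ.+ D))
        ≈⟨ +-congˡ (castℕ-* ((p ℕ.∸ 1) ℕ.^ suc (j ℕ.+ D)) ((n ℕ.+ D) C (j ℕ.+ D))) ⟨
      castℕ ((n ℕ.+ D) C D) + castℕ ((p ℕ.∸ 1) ℕ.^ suc (j ℕ.+ D) ℕ.* ((n ℕ.+ D) C (j ℕ.+ D)))
        ≈⟨ castℕ-+ ((n ℕ.+ D) C D) ((p ℕ.∸ 1) ℕ.^ suc (j ℕ.+ D) ℕ.* ((n ℕ.+ D) C (j ℕ.+ D))) ⟨
      castℕ B ∎))

    a₁₀≈ : a₁₀ j n ≈ - (T * castℕ C′)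
    a₁₀≈ = -‿cong (*-congˡ (trans (+-identityˡ _) (trans (*-congʳ (sgn-castℕ (suc j))) (sym (castℕ-* ((p ℕ.∸ 1) ℕ.^ suc j) (n C j))))))

    discriminant≈ : discriminant (a₀₀ j n) (a₀₁ j n) (a₁₀ j n) 0# ≈ (T * T) * (castℕ (A ℕ.* A) + pow t D * castℕ (4 ℕ.* (B ℕ.* C′)))
    discriminant≈ = begin
      discriminant (a₀₀ j n) (a₀₁ j n) (a₁₀ j n) 0#
        ≈⟨ +-congˡ (*-congˡ (*-cong a₀₁≈ a₁₀≈)) ⟩
      (a₀₀ j n - 0#) * (a₀₀ j n - 0#) + ιℕ 4 * ((- (T′ * b)) * (- (T * c′)))
        ≈⟨ solve 6 (λ P α T′ T b c′ → (:- (P :* α) :- con (+ 0)) :* (:- (P :* α) :- con (+ 0)) :+ con (+ 4) :* ((:- (T′ :* b)) :* (:- (T :* c′)))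
                                   := (P :* P) :* (α :* α) :+ con (+ 4) :* ((T′ :* T) :* (b :* c′))) refl
                  (pow (- t) (suc j)) (castℕ A) T′ T b c′ ⟩
      (pow (- t) (suc j) * pow (- t) (suc j)) * (castℕ A * castℕ A) + ιℕ 4 * ((T′ * T) * (b * c′))
        ≈⟨ +-cong (*-cong (pow-neg-square t (suc j)) (sym (castℕ-* A A)))
                  (*-cong (sym (castℕ≈ιℕ 4)) (*-cong (*-congʳ (pow-+ t (suc j) D)) (sym (castℕ-* B C′)))) ⟩
      (T * T) * castℕ (A ℕ.* A) + castℕ 4 * (((T * pow t D) * T) * castℕ (B ℕ.* C′))
        ≈⟨ solve 5 (λ T tD a f bc → (T :* T) :* a :+ f :* (((T :* tD) :* T) :* bc) := (T :* T) :* (a :+ tD :* (f :* bc))) refl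
                  T (pow t D) (castℕ (A ℕ.* A)) (castℕ 4) (castℕ (B ℕ.* C′)) ⟩
      (T * T) * (castℕ (A ℕ.* A) + pow t D * (castℕ 4 * castℕ (B ℕ.* C′)))
        ≈⟨ *-congˡ (+-congˡ (*-congˡ (castℕ-* 4 (B ℕ.* C′)))) ⟨
      (T * T) * (castℕ (A ℕ.* A) + pow t D * castℕ (4 ℕ.* (B ℕ.* C′))) ∎
      where
      T′ = pow t (suc (j ℕ.+ D))
      b = castℕ B
      c′ = castℕ C′

    diagonalizable : ¬ p ∣ A → Diagonalizable (Pair j n)
    diagonalizable p∤A = distinct-eigenvalues-diagonalizable isField closed
      (-tᵐN≈0? (suc (j ℕ.+ D)) B a₀₁≈) (-tᵐN≈0? (suc j) C′ a₁₀≈)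
      (λ disc≈0 → *-nonzero isField (*-nonzero isField (pow-t-nonzero (suc j)) (pow-t-nonzero (suc j)))
         (X+tY-nonzero p∤A² e (4 ℕ.* (B ℕ.* C′))) (trans (sym discriminant≈) disc≈0))
      where
      p∤A² : ¬ p ∣ A ℕ.* A
      p∤A² p∣A² with euclidsLemma A A pr p∣A²
      ... | inj₁ p∣A = p∤A p∣A
      ... | inj₂ p∣A = p∤A p∣A

  -- Case p ∣ C(D + n, j), with n = m + 1 and j = i + 1.  By the Lucas shifts
  -- C(D + n, j) ≡ C(m, j), C(n + D, D) ≡ C(m, D) = 0, C(n + D, j + D) ≡ C(m, i) and
  -- C(n, j) = C(m, i) + C(m, j), so with h = C(m, i) the matrix is
  -- [[0, - t^(j+D+1) σ′ h], [- t^(j+1) σ h, 0]] (σ, σ′ signs).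
  module MultipleCase (i m : ℕ) (j<D : suc i < D) (n<D : suc m < D) (p∣A : p ∣ (D ℕ.+ suc m) C suc i) where
    j n : ℕ
    j = suc i
    n = suc m

    h : Carrier
    h = castℕ (m C i)

    m<D : m < D
    m<D = ℕP.<-trans (ℕP.n<1+n m) n<D

    C[m,j]≈0 : castℕ (m C j) ≈ 0#
    C[m,j]≈0 = trans (sym (shift-below m j (ℕP.m<n⇒m<1+n j<D)))
                     (castℕ-∣ (P.subst (λ x → p ∣ x C j) D+n≡m+q p∣A))
      where
      D+n≡m+q : D ℕ.+ suc m ≡ m ℕ.+ suc D
      D+n≡m+q = P.trans (ℕP.+-suc D m) (ℕP.+-comm (suc D) m)

    a₀₀≈0 : a₀₀ j n ≈ 0#
    a₀₀≈0 = trans (-‿cong (trans (*-congˡ (castℕ-∣ p∣A)) (zeroʳ _))) -0#≈0#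

    n+D≡m+q : n ℕ.+ D ≡ m ℕ.+ suc D
    n+D≡m+q = P.sym (ℕP.+-suc m D)

    a₀₁≈ : a₀₁ j n ≈ - (pow t (suc (j ℕ.+ D)) * (sgn (suc (j ℕ.+ D)) * h))
    a₀₁≈ = -‿cong (*-congˡ (begin
      castℕ ((n ℕ.+ D) C D) + sgn (suc (j ℕ.+ D)) * castℕ ((n ℕ.+ D) C (j ℕ.+ D))
        ≈⟨ +-cong C[n+D,D]≈0 (*-congˡ C[n+D,j+D]≈h) ⟩
      0# + sgn (suc (j ℕ.+ D)) * h
        ≈⟨ +-identityˡ _ ⟩
      sgn (suc (j ℕ.+ D)) * h ∎))
      where
      C[n+D,D]≈0 : castℕ ((n ℕ.+ D) C D) ≈ 0#
      C[n+D,D]≈0 = begin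
        castℕ ((n ℕ.+ D) C D)         ≡⟨ P.cong (λ x → castℕ (x C D)) n+D≡m+q ⟩
        castℕ ((m ℕ.+ suc D) C D)     ≈⟨ shift-below m D (ℕP.n<1+n D) ⟩
        castℕ (m C D)                 ≡⟨ P.cong castℕ (k>n⇒nCk≡0 m<D) ⟩
        0#                            ∎
      C[n+D,j+D]≈h : castℕ ((n ℕ.+ D) C (j ℕ.+ D)) ≈ h
      C[n+D,j+D]≈h = begin
        castℕ ((n ℕ.+ D) C (j ℕ.+ D))               ≡⟨ P.cong₂ (λ x y → castℕ (x C y)) n+D≡m+q (P.sym (ℕP.+-suc i D)) ⟩
        castℕ ((m ℕ.+ suc D) C (i ℕ.+ suc D))       ≈⟨ shift-above m i (ℕP.<-trans (ℕP.n<1+n i) (ℕP.m<n⇒m<1+n j<D)) ⟩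
        castℕ (m C (i ℕ.+ suc D)) + h               ≡⟨ P.cong (λ x → castℕ x + h) (k>n⇒nCk≡0 m<i+q) ⟩
        0# + h                                      ≈⟨ +-identityˡ h ⟩
        h                                           ∎
        where
        m<i+q : m < i ℕ.+ suc D
        m<i+q = ℕP.<-≤-trans m<D (ℕP.≤-trans (ℕP.n≤1+n D) (ℕP.m≤n+m (suc D) i))

    a₁₀≈ : a₁₀ j n ≈ - (pow t (suc j) * (sgn (suc j) * h))
    a₁₀≈ = -‿cong (*-congˡ (trans (+-identityˡ _) (*-congˡ (begin
      castℕ (n C j)               ≈⟨ castℕ-pascal m i ⟩
      h + castℕ (m C j)           ≈⟨ +-congˡ C[m,j]≈0 ⟩
      h + 0#                      ≈⟨ +-identityʳ h ⟩
      h                           ∎))))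

    vanishing : h ≈ 0# → Diagonalizable (Pair j n)
    vanishing h≈0 = diagonal-diagonalizable isField (trans a₀₁≈ (-tσh≈0 _ _)) (trans a₁₀≈ (-tσh≈0 _ _))
      where
      -tσh≈0 : ∀ x σ → - (x * (σ * h)) ≈ 0#
      -tσh≈0 x σ = trans (-‿cong (trans (*-congˡ (trans (*-congˡ h≈0) (zeroʳ σ))) (zeroʳ x))) -0#≈0#

    distinct : ¬ p ≡ 2 → ¬ (h ≈ 0#) → Diagonalizable (Pair j n)
    distinct p≢2 h≉0 = distinct-eigenvalues-diagonalizable isField closed (no b≉0) (no c≉0) disc≉0
      where
      T′ T σ′ σ : Carrier
      T′ = pow t (suc (j ℕ.+ D))
      T = pow t (suc j)
      σ′ = sgn (suc (j ℕ.+ D))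
      σ = sgn (suc j)
      -tσh≉0 : ∀ l → ¬ (- (pow t l * (sgn l * h)) ≈ 0#)
      -tσh≉0 l = -‿nonzero (*-nonzero isField (pow-t-nonzero l) (*-nonzero isField (sgn-nonzero isField l) h≉0))
      b≉0 : ¬ (a₀₁ j n ≈ 0#)
      b≉0 b≈0 = -tσh≉0 (suc (j ℕ.+ D)) (trans (sym a₀₁≈) b≈0)
      c≉0 : ¬ (a₁₀ j n ≈ 0#)
      c≉0 c≈0 = -tσh≉0 (suc j) (trans (sym a₁₀≈) c≈0)
      p∤4 : ¬ p ∣ 4
      p∤4 p∣4 with euclidsLemma 2 2 pr p∣4
      ... | inj₁ p∣2 = p≢2 (prime∣2⇒≡2 p∣2)
      ... | inj₂ p∣2 = p≢2 (prime∣2⇒≡2 p∣2)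
      disc≈ : discriminant (a₀₀ j n) (a₀₁ j n) (a₁₀ j n) 0# ≈ castℕ 4 * ((T′ * T) * ((σ′ * σ) * (h * h)))
      disc≈ = begin
        discriminant (a₀₀ j n) (a₀₁ j n) (a₁₀ j n) 0#
          ≈⟨ +-cong (*-cong (+-congʳ a₀₀≈0) (+-congʳ a₀₀≈0)) (*-cong (sym (castℕ≈ιℕ 4)) (*-cong a₀₁≈ a₁₀≈)) ⟩
        (0# - 0#) * (0# - 0#) + castℕ 4 * ((- (T′ * (σ′ * h))) * (- (T * (σ * h))))
          ≈⟨ solve 6 (λ f T′ T σ′ σ h → (con (+ 0) :- con (+ 0)) :* (con (+ 0) :- con (+ 0)) :+ f :* ((:- (T′ :* (σ′ :* h))) :* (:- (T :* (σ :* h))))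
                                       := f :* ((T′ :* T) :* ((σ′ :* σ) :* (h :* h)))) refl (castℕ 4) T′ T σ′ σ h ⟩
        castℕ 4 * ((T′ * T) * ((σ′ * σ) * (h * h))) ∎
      disc≉0 : ¬ (discriminant (a₀₀ j n) (a₀₁ j n) (a₁₀ j n) 0# ≈ 0#)
      disc≉0 disc≈0 = *-nonzero isField (castℕ-nonzero p∤4)
        (*-nonzero isField (*-nonzero isField (pow-t-nonzero (suc (j ℕ.+ D))) (pow-t-nonzero (suc j)))
          (*-nonzero isField (*-nonzero isField (sgn-nonzero isField (suc (j ℕ.+ D))) (sgn-nonzero isField (suc j))) (*-nonzero isField h≉0 h≉0)))
        (trans (sym disc≈) disc≈0)

    -- In characteristic 2 with k even, h = C(m, i) ≡ C(m, i + 1) ≡ 0 mod 2 (as m + i + 1 is even).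
    even-k : p ≡ 2 → 2 ∣ Entries.k j n → p ∣ m C i
    even-k p≡2 2∣k = P.subst (_∣ m C i) (P.sym p≡2) (even-binomial m i 2∣m+j 2∣C[m,j])
      where
      2∣m+j : 2 ∣ m ℕ.+ suc i
      2∣m+j = ∣m+n∣m⇒∣n (P.subst (2 ∣_) (k-split i D m) 2∣k) (∣m∣n⇒∣m+n (P.subst (_∣ suc D) p≡2 p∣q) (∣-refl {2}))
      2∣C[m,j] : 2 ∣ m C suc i
      2∣C[m,j] = P.subst (_∣ m C suc i) p≡2 (castℕ≈0⇒∣ C[m,j]≈0)

    diagonalizable : (2 ∣ suc D → ¬ 2 ∣ Entries.k j n → a₀₀ j n ≈ 0# → ⊥) → Diagonalizable (Pair j n)
    diagonalizable exception with p ∣? m C i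
    ... | yes p∣h = vanishing (castℕ-∣ p∣h)
    ... | no p∤h with p ℕP.≟ 2
    ...   | no p≢2 = distinct p≢2 (castℕ-nonzero p∤h)
    ...   | yes p≡2 with 2 ∣? Entries.k j n
    ...     | yes 2∣k = ⊥-elim (p∤h (even-k p≡2 2∣k))
    ...     | no 2∤k = ⊥-elim (exception (P.subst (_∣ suc D) p≡2 p∣q) 2∤k a₀₀≈0)

  -- Combining the cases.  If p ∣ C(D + n, j) then n ≠ 0, as C(D, j) ≡ ±1,
  -- and j ≠ 0, as C(D + n, 0) = 1.
  pair-diagonalizable : ∀ j n → j < D → n < D →
    (2 ∣ suc D → ¬ 2 ∣ Entries.k j n → a₀₀ j n ≈ 0# → ⊥) → Diagonalizable (Pair j n)
  pair-diagonalizable j n _ _ _ with p ∣? (D ℕ.+ n) C j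
  pair-diagonalizable j n _ _ _ | no p∤A = UnitCase.diagonalizable j n p∤A
  pair-diagonalizable j zero j<D _ _ | yes p∣A = ⊥-elim (sgn-nonzero isField j (begin
    sgn j                       ≈⟨ binomial-q-1 j (ℕP.<⇒≤ j<D) ⟨
    castℕ (D C j)               ≡⟨ P.cong (λ x → castℕ (x C j)) (ℕP.+-identityʳ D) ⟨
    castℕ ((D ℕ.+ 0) C j)       ≈⟨ castℕ-∣ p∣A ⟩
    0#                          ∎))
  pair-diagonalizable zero (suc m) _ _ _ | yes p∣1 = ⊥-elim (prime∤1 p∣1)
  pair-diagonalizable (suc i) (suc m) j<D n<D exception | yes p∣A =
    MultipleCase.diagonalizable i m j<D n<D p∣A exception

  class-diagonalizable : ∀ j n → j < D → n < D → (L : List ℕ) → L ≡ j ∷ j ℕ.+ D ∷ [] →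
    ¬ (2 ∣ suc D × ¬ 2 ∣ Entries.k j n × DiagZero (Entries.UMatrix j n L)) →
    Diagonalizable (Entries.UMatrix j n L)
  class-diagonalizable j n j<D n<D _ P.refl exception =
    Diagonalizable-resp {M = UMatrix (j ∷ j ℕ.+ D ∷ [])} {N = Pair j n}
      (≈M-entries (reflexive entry₀₀) (reflexive entry₀₁) (reflexive entry₁₀) (entry₁₁ n<D))
      (pair-diagonalizable j n j<D n<D (λ 2∣q 2∤k a₀₀≈0 → exception (2∣q , 2∤k , diagonal-zero a₀₀≈0)))
    where
    open Entries j n using (entry₀₀; entry₀₁; entry₁₀; entry₁₁; UMatrix)
    diagonal-zero : a₀₀ j n ≈ 0# → DiagZero (UMatrix (j ∷ j ℕ.+ D ∷ []))
    diagonal-zero a₀₀≈0 zero = trans (reflexive entry₀₀) a₀₀≈0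
    diagonal-zero a₀₀≈0 (suc zero) = entry₁₁ n<D

theorem1p1 : ∀ {c ℓ : Level} (K : CommutativeRing c ℓ) →
    Over.IsField K → Over.IsAlgClosed K →
    (p r q : ℕ) → Prime p → 1 ≤ r → q ≡ p ^ r → Over.HasChar K p →
    (t : CommutativeRing.Carrier K) → Over.Transcendental K p t →
    (k j : ℕ) → 2 ≤ k → j ≤ q ∸ 2 →
    length (Cls q k j) ≡ 2 →
    ¬ ((2 ∣ q) × (¬ (2 ∣ k)) × Over.DiagZero K (Over.Mj K t q k j)) →
    Over.Diagonalizable K (Over.Mj K t q k j)
-- q = e + 2 and k = k-1 + 1; the class has the two elements j, j + D with
-- k - 2 = j + D + n, and the matrix is handled by TwoElementClass.
theorem1p1 K isField closed p r q pr 1≤r q≡p^r char t transcendental k j 2≤k j≤q-2 two-elements exception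
  with ℕP.m≤n⇒∃[o]m+o≡n (P.subst (2 ≤_) (P.sym q≡p^r) (PrimePowers.prime-power≥2 pr r 1≤r))
... | e , P.refl with 2≤k
...   | s≤s {n = k-1} _ with ResidueClass.two-members e j (s≤s j≤q-2) k-1 two-elements
...     | n , n<D , P.refl , class≡ =
  TwoElementClass.class-diagonalizable K isField closed pr char t transcendental r 1≤r e q≡p^r
    j n (s≤s j≤q-2) n<D _ class≡ exception
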